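{- Let $n\ge 1$ and let $h=(h_1,\ldots,h_n)$ be a Hessenberg function. Then $I_h=J_h$ as ideals of $\mathbb{Z}[x_1,\ldots,x_n]$.
   Context: A Hessenberg function is an $n$-tuple $h=(h_1,\ldots,h_n)$ of integers with $i\le h_i\le n$ for all $i$ and $h_i\le h_{i+1}$ for $1\le i\le n-1$. For $S\subseteq\{1,\ldots,n\}$ and an integer $d$: the truncated elementary symmetric function $e_d(S)$ is the sum of all squarefree monomials $x_{i_1}\cdots x_{i_d}$ with $i_1<\cdots<i_d$ in $S$; the truncated complete symmetric function $\tilde e_d(S)$ is the sum of all monomials $x_{i_1}\cdots x_{i_d}$ with $i_1\le\cdots\le i_d$ in $S$. Conventions: $e_0(S)=\tilde e_0(S)=1$ (also for $S=\emptyset$), both are $0$ for $d<0$, $e_d(S)=0$ for $d>|S|$, and $\tilde e_d(\emptyset)=0$ for $d>0$. We write $e_d(a,\ldots,b)$, $\tilde e_d(a,\ldots,b)$ for $S=\{a,a+1,\ldots,b\}$. The ideal $I_h$ is the ideal of $\mathbb{Z}[x_1,\ldots,x_n]$ generated by $\mathfrak{C}_h=\{e_{h_i-r}(1,\ldots,h_i): 1\le i\le n,\ 0\le r\le i-1\}$. The degree tuple of $h$ is $\beta=(\beta_n,\ldots,\beta_1)$ with $\beta_i=i-\#\{k: h_k<i\}$, and $J_h$ is the ideal generated by $\tilde e_{\beta_i}(i,i+1,\ldots,n)$ for $i=1,\ldots,n$. -}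

module Defs where

open import Data.Nat as ℕ using (ℕ; zero; suc; _∸_; _≤_; _<_; _<?_)
open import Data.Integer as ℤ using (ℤ)
open import Data.Fin using (Fin; toℕ)
open import Data.Vec using (Vec; tabulate; zipWith; replicate)
open import Data.Vec.Properties using (≡-dec)
open import Data.List using (List; []; _∷_; _++_; map; concatMap; upTo; length; filter)
open import Data.List.Relation.Unary.All using (All)
open import Data.List.Membership.Propositional using (_∈_)
open import Data.Product using (Σ; _×_; _,_)
open import Relation.Binary.PropositionalEquality using (_≡_)
open import Relation.Nullary using (yes; no)

-- Polynomials in ℤ[x₁,…,xₙ] as finite formal sums of terms c·x^e,
-- with exponent vectors e : Vec ℕ n (position j ↔ variable x_{j+1}).
-- Equality of polynomials is equality of all coefficients.

Mono : ℕ → Set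
Mono n = Vec ℕ n

Poly : ℕ → Set
Poly n = List (ℤ × Mono n)

coeff : ∀ {n} → Poly n → Mono n → ℤ
coeff [] e = ℤ.0ℤ
coeff ((c , m) ∷ p) e with ≡-dec ℕ._≟_ m e
... | yes _ = c ℤ.+ coeff p e
... | no  _ = coeff p e

infix 4 _≈_
_≈_ : ∀ {n} → Poly n → Poly n → Set
p ≈ q = ∀ e → coeff p e ≡ coeff q e

infixl 6 _⊕_
_⊕_ : ∀ {n} → Poly n → Poly n → Poly n
p ⊕ q = p ++ q

infixl 7 _⊗_
_⊗_ : ∀ {n} → Poly n → Poly n → Poly n
p ⊗ q = concatMap (λ { (c , m) → map (λ { (d , k) → (c ℤ.* d , zipWith ℕ._+_ m k) }) q }) p

0P : ∀ {n} → Poly n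
0P = []

1P : ∀ {n} → Poly n
1P {n} = (ℤ.1ℤ , replicate n 0) ∷ []

-- the variable x_k (1-based index k; only used for 1 ≤ k ≤ n)
var : ∀ {n} → ℕ → Poly n
var {n} k = (ℤ.1ℤ , tabulate (λ (j : Fin n) → eqb (suc (toℕ j)) k)) ∷ []
  where
  eqb : ℕ → ℕ → ℕ
  eqb a b with a ℕ.≟ b
  ... | yes _ = 1
  ... | no  _ = 0

sumP : ∀ {n} → List (Poly n) → Poly n
sumP [] = 0P
sumP (p ∷ ps) = p ⊕ sumP ps

InIdeal : ∀ {n} → List (Poly n) → Poly n → Set
InIdeal {n} gs p =
  Σ (List (Poly n × Poly n)) λ ts →
    All (λ t → Data.Product.proj₂ t ∈ gs) ts ×
    p ≈ sumP (map (λ t → Data.Product.proj₁ t ⊗ Data.Product.proj₂ t) ts)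

-- index ranges {a, a+1, …, b} (empty if b < a)

range : ℕ → ℕ → List ℕ
range a b = map (a ℕ.+_) (upTo (suc b ∸ a))

eSym : ∀ {n} → ℕ → List ℕ → Poly n
eSym zero    _       = 1P
eSym (suc d) []      = 0P
eSym (suc d) (a ∷ L) = var a ⊗ eSym d L ⊕ eSym (suc d) L

hSym : ∀ {n} → ℕ → List ℕ → Poly n
hSym zero    _       = 1P
hSym (suc d) []      = 0P
hSym (suc d) (a ∷ L) = var a ⊗ hSym d (a ∷ L) ⊕ hSym (suc d) L

-- Hessenberg functions: h is given as a function ℕ → ℕ whose values
-- at 1,…,n form the tuple (h₁,…,hₙ).

record IsHessenberg (n : ℕ) (h : ℕ → ℕ) : Set where
  field
    lower : ∀ i → 1 ≤ i → i ≤ n → i ≤ h i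
    upper : ∀ i → 1 ≤ i → i ≤ n → h i ≤ n
    mono  : ∀ i → 1 ≤ i → i < n → h i ≤ h (suc i)

-- generators 𝔠_h = { e_{h_i - r}(1,…,h_i) : 1 ≤ i ≤ n, 0 ≤ r ≤ i-1 }
-- (h_i - r ≥ 1 for Hessenberg h, so truncated subtraction is exact)
Cgens : (n : ℕ) → (ℕ → ℕ) → List (Poly n)
Cgens n h = concatMap (λ i → map (λ r → eSym (h i ∸ r) (range 1 (h i))) (upTo i)) (range 1 n)

-- β_i = i - #{k ∈ {1..n} : h_k < i}  (nonnegative for Hessenberg h)
β : (n : ℕ) → (ℕ → ℕ) → ℕ → ℕ
β n h i = i ∸ length (filter (λ k → h k <? i) (range 1 n))

Jgens : (n : ℕ) → (ℕ → ℕ) → List (Poly n)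
Jgens n h = map (λ i → hSym (β n h i) (range i n)) (range 1 n)

-- Everything rests on the generating-series identity E_L(−t) · H_{L ++ M}(t) = H_M(t), i.e.
--   Σ_k (−1)^k e_k(1, …, m) ẽ_{d−k}(1, …, n) = ẽ_d(m+1, …, n).
-- Both ideals contain ẽ_d(1, …, n) for every d ≥ 1: J_h because ẽ_d(j, …, n) ∈ J_h whenever
-- d ≥ β_j (peel off x_j and use β_{j+1} ≤ β_j + 1), and I_h because h_n = n puts every
-- e_d(1, …, n) in I_h and the identity with M = [] expresses ẽ_d through them.  Modulo these
-- terms the identity reads ẽ_d(m+1, …, n) ≡ ±e_d(1, …, m).  For m = h_i the generator
-- e_{h_i−r}(1, …, h_i) of I_h therefore lies in J_h, because β_{h_i+1} ≤ h_i + 1 − i.  For d = β_{m+1}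
-- the generator of J_h lies in I_h: with t the last index such that h_t ≤ m, the element
-- e_d(1, …, m) is built from the generators e_{d′}(1, …, h_t) by adjoining x_{h_t+1}, …, x_m.

module Submission where

open import Defs hiding (_≈_)
open import Level using (0ℓ; _⊔_)
open import Data.Nat as ℕ using (ℕ; zero; suc; _≤_; _<_; z≤n; s≤s)
import Data.Nat.Properties as ℕ
open import Data.Integer as ℤ using (ℤ)
import Data.Integer.Properties as ℤ
open import Data.Vec as Vec using ([]; _∷_; zipWith; replicate)
import Data.Vec.Properties as Vec
open import Data.List as List using (List; []; _∷_; _++_; map; filter; length)
import Data.List.Properties as List
open import Data.List.Relation.Unary.All as All using (All; []; _∷_)
import Data.List.Relation.Unary.All.Properties as All
open import Data.List.Membership.Propositional using (_∈_; find; lose)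
open import Data.List.Membership.Propositional.Properties
  using (∈-map⁺; ∈-map⁻; ∈-concatMap⁺; ∈-concatMap⁻; ∈-upTo⁺; ∈-upTo⁻)
open import Data.List.Relation.Unary.Any using (here; there)
open import Data.Product using (∃; _×_; _,_; proj₁; proj₂)
open import Data.Sum using (_⊎_; inj₁; inj₂)
open import Data.Empty using (⊥-elim)
open import Function using (_∘_)
open import Relation.Binary.PropositionalEquality as ≡
  using (_≡_; _≢_; refl; cong; cong₂; subst; module ≡-Reasoning)
open import Relation.Nullary using (yes; no)
open import Relation.Unary using (Pred; Decidable)
open import Relation.Binary.Structures using (IsEquivalence)
open import Algebra.Bundles using (CommutativeRing)
open import Algebra.Properties.CommutativeSemigroup ℤ.+-commutativeSemigroup using (interchange)

module PolynomialArithmetic where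
  open Defs using (_≈_)

  infixl 6 _⊞_
  _⊞_ : ∀ {n} → Mono n → Mono n → Mono n
  _⊞_ = zipWith ℕ._+_

  ⊞-cancelˡ : ∀ {n} (m k e : Mono n) → m ⊞ k ≡ m ⊞ e → k ≡ e
  ⊞-cancelˡ [] [] [] _ = refl
  ⊞-cancelˡ (a ∷ m) (b ∷ k) (c ∷ e) eq =
    cong₂ _∷_ (ℕ.+-cancelˡ-≡ a b c (cong Vec.head eq)) (⊞-cancelˡ m k e (cong Vec.tail eq))

  ⊞-divides? : ∀ {n} (m e : Mono n) → (∃ λ e′ → e ≡ m ⊞ e′) ⊎ (∀ k → m ⊞ k ≢ e)
  ⊞-divides? [] [] = inj₁ ([] , refl)
  ⊞-divides? (a ∷ m) (b ∷ e) with a ℕ.≤? b | ⊞-divides? m e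
  ... | yes a≤b | inj₁ (e′ , eq) = inj₁ (b ℕ.∸ a ∷ e′ , cong₂ _∷_ (≡.sym (ℕ.m+[n∸m]≡n a≤b)) eq)
  ... | yes _   | inj₂ m∤e       = inj₂ λ { (_ ∷ k) eq → m∤e k (cong Vec.tail eq) }
  ... | no a≰b  | _              = inj₂ λ { (c ∷ _) eq → a≰b (subst (a ≤_) (cong Vec.head eq) (ℕ.m≤m+n a c)) }

  module _ {n : ℕ} where

    mulTerm : ℤ → Mono n → Poly n → Poly n
    mulTerm c m = map λ { (d , k) → (c ℤ.* d , m ⊞ k) }

    coeff-++ : ∀ (p q : Poly n) e → coeff (p ++ q) e ≡ coeff p e ℤ.+ coeff q e
    coeff-++ [] q e = ≡.sym (ℤ.+-identityˡ _)
    coeff-++ ((c , m) ∷ p) q e with Vec.≡-dec ℕ._≟_ m e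
    ... | yes _ = ≡.trans (cong (λ x → c ℤ.+ x) (coeff-++ p q e)) (≡.sym (ℤ.+-assoc c _ _))
    ... | no _  = coeff-++ p q e

    negate : Poly n → Poly n
    negate = map λ (c , m) → (ℤ.- c , m)

    coeff-negate : ∀ (p : Poly n) e → coeff (negate p) e ≡ ℤ.- coeff p e
    coeff-negate [] e = refl
    coeff-negate ((c , m) ∷ p) e with Vec.≡-dec ℕ._≟_ m e
    ... | yes _ = ≡.trans (cong (λ x → ℤ.- c ℤ.+ x) (coeff-negate p e)) (≡.sym (ℤ.neg-distrib-+ c _))
    ... | no _  = coeff-negate p e

    coeff-mulTerm-⊞ : ∀ c m (q : Poly n) e → coeff (mulTerm c m q) (m ⊞ e) ≡ c ℤ.* coeff q e
    coeff-mulTerm-⊞ c m [] e = ≡.sym (ℤ.*-zeroʳ c)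
    coeff-mulTerm-⊞ c m ((d , k) ∷ q) e with Vec.≡-dec ℕ._≟_ (m ⊞ k) (m ⊞ e) | Vec.≡-dec ℕ._≟_ k e
    ... | yes _  | yes _   = ≡.trans (cong (λ x → c ℤ.* d ℤ.+ x) (coeff-mulTerm-⊞ c m q e)) (≡.sym (ℤ.*-distribˡ-+ c d _))
    ... | no _   | no _    = coeff-mulTerm-⊞ c m q e
    ... | yes eq | no k≢e  = ⊥-elim (k≢e (⊞-cancelˡ m k e eq))
    ... | no ne  | yes k≡e = ⊥-elim (ne (cong (m ⊞_) k≡e))

    coeff-mulTerm-∤ : ∀ c m (q : Poly n) e → (∀ k → m ⊞ k ≢ e) → coeff (mulTerm c m q) e ≡ ℤ.0ℤ
    coeff-mulTerm-∤ c m [] e m∤e = refl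
    coeff-mulTerm-∤ c m ((d , k) ∷ q) e m∤e with Vec.≡-dec ℕ._≟_ (m ⊞ k) e
    ... | yes eq = ⊥-elim (m∤e k eq)
    ... | no _   = coeff-mulTerm-∤ c m q e m∤e

    mulTerm-cong : ∀ c m (q q′ : Poly n) → q ≈ q′ → mulTerm c m q ≈ mulTerm c m q′
    mulTerm-cong c m q q′ q≈q′ e with ⊞-divides? m e
    ... | inj₁ (e′ , refl) = begin
        coeff (mulTerm c m q) (m ⊞ e′)   ≡⟨ coeff-mulTerm-⊞ c m q e′ ⟩
        c ℤ.* coeff q e′                 ≡⟨ cong (c ℤ.*_) (q≈q′ e′) ⟩
        c ℤ.* coeff q′ e′                ≡⟨ coeff-mulTerm-⊞ c m q′ e′ ⟨
        coeff (mulTerm c m q′) (m ⊞ e′)  ∎ where open ≡-Reasoning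
    ... | inj₂ m∤e = ≡.trans (coeff-mulTerm-∤ c m q e m∤e) (≡.sym (coeff-mulTerm-∤ c m q′ e m∤e))

    mulTerm-mulTerm : ∀ c m d k (r : Poly n) → mulTerm c m (mulTerm d k r) ≡ mulTerm (c ℤ.* d) (m ⊞ k) r
    mulTerm-mulTerm c m d k [] = refl
    mulTerm-mulTerm c m d k ((a , l) ∷ r) =
      cong₂ _∷_ (cong₂ _,_ (≡.sym (ℤ.*-assoc c d a)) (≡.sym (Vec.zipWith-assoc ℕ.+-assoc m k l)))
                (mulTerm-mulTerm c m d k r)

    mulTerm-one : ∀ (p : Poly n) → mulTerm ℤ.1ℤ (replicate n 0) p ≡ p
    mulTerm-one [] = refl
    mulTerm-one ((d , k) ∷ p) =
      cong₂ _∷_ (cong₂ _,_ (ℤ.*-identityˡ d) (Vec.zipWith-identityˡ ℕ.+-identityˡ k)) (mulTerm-one p)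

    ⊗-distribʳ-++ : ∀ (p₁ p₂ q : Poly n) → (p₁ ++ p₂) ⊗ q ≡ p₁ ⊗ q ++ p₂ ⊗ q
    ⊗-distribʳ-++ p₁ p₂ q = List.concatMap-++ _ p₁ p₂

    ⊗-distribˡ-++ : ∀ (q p₁ p₂ : Poly n) e → coeff (q ⊗ (p₁ ++ p₂)) e ≡ coeff (q ⊗ p₁) e ℤ.+ coeff (q ⊗ p₂) e
    ⊗-distribˡ-++ [] p₁ p₂ e = refl
    ⊗-distribˡ-++ ((c , m) ∷ q) p₁ p₂ e = begin
        coeff (mulTerm c m (p₁ ++ p₂) ++ q ⊗ (p₁ ++ p₂)) e
      ≡⟨ coeff-++ (mulTerm c m (p₁ ++ p₂)) _ e ⟩
        coeff (mulTerm c m (p₁ ++ p₂)) e ℤ.+ coeff (q ⊗ (p₁ ++ p₂)) e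
      ≡⟨ cong₂ ℤ._+_ (≡.trans (cong (λ z → coeff z e) (List.map-++ _ p₁ p₂)) (coeff-++ (mulTerm c m p₁) _ e))
                     (⊗-distribˡ-++ q p₁ p₂ e) ⟩
        (coeff (mulTerm c m p₁) e ℤ.+ coeff (mulTerm c m p₂) e) ℤ.+ (coeff (q ⊗ p₁) e ℤ.+ coeff (q ⊗ p₂) e)
      ≡⟨ interchange (coeff (mulTerm c m p₁) e) (coeff (mulTerm c m p₂) e) (coeff (q ⊗ p₁) e) (coeff (q ⊗ p₂) e) ⟩
        (coeff (mulTerm c m p₁) e ℤ.+ coeff (q ⊗ p₁) e) ℤ.+ (coeff (mulTerm c m p₂) e ℤ.+ coeff (q ⊗ p₂) e)
      ≡⟨ cong₂ ℤ._+_ (coeff-++ (mulTerm c m p₁) _ e) (coeff-++ (mulTerm c m p₂) _ e) ⟨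
        coeff (mulTerm c m p₁ ++ q ⊗ p₁) e ℤ.+ coeff (mulTerm c m p₂ ++ q ⊗ p₂) e
      ∎ where open ≡-Reasoning

    ⊗-zeroʳ : ∀ (q : Poly n) → q ⊗ [] ≡ []
    ⊗-zeroʳ [] = refl
    ⊗-zeroʳ (_ ∷ q) = ⊗-zeroʳ q

    ⊗-term : ∀ (q : Poly n) c m → q ⊗ ((c , m) ∷ []) ≡ mulTerm c m q
    ⊗-term [] c m = refl
    ⊗-term ((d , k) ∷ q) c m =
      cong₂ _∷_ (cong₂ _,_ (ℤ.*-comm d c) (Vec.zipWith-comm ℕ.+-comm k m)) (⊗-term q c m)

    ⊗-comm : ∀ (p q : Poly n) → p ⊗ q ≈ q ⊗ p
    ⊗-comm [] q e = cong (λ z → coeff z e) (≡.sym (⊗-zeroʳ q))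
    ⊗-comm ((c , m) ∷ p) q e = begin
        coeff (mulTerm c m q ++ p ⊗ q) e
      ≡⟨ coeff-++ (mulTerm c m q) _ e ⟩
        coeff (mulTerm c m q) e ℤ.+ coeff (p ⊗ q) e
      ≡⟨ cong₂ ℤ._+_ (cong (λ z → coeff z e) (≡.sym (⊗-term q c m))) (⊗-comm p q e) ⟩
        coeff (q ⊗ ((c , m) ∷ [])) e ℤ.+ coeff (q ⊗ p) e
      ≡⟨ ⊗-distribˡ-++ q ((c , m) ∷ []) p e ⟨
        coeff (q ⊗ ((c , m) ∷ p)) e
      ∎ where open ≡-Reasoning

    mulTerm-⊗ : ∀ c m (q r : Poly n) → mulTerm c m q ⊗ r ≡ mulTerm c m (q ⊗ r)
    mulTerm-⊗ c m [] r = refl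
    mulTerm-⊗ c m ((d , k) ∷ q) r = begin
        mulTerm (c ℤ.* d) (m ⊞ k) r ++ mulTerm c m q ⊗ r
      ≡⟨ cong₂ _++_ (≡.sym (mulTerm-mulTerm c m d k r)) (mulTerm-⊗ c m q r) ⟩
        mulTerm c m (mulTerm d k r) ++ mulTerm c m (q ⊗ r)
      ≡⟨ List.map-++ _ (mulTerm d k r) _ ⟨
        mulTerm c m (mulTerm d k r ++ q ⊗ r)
      ∎ where open ≡-Reasoning

    ⊗-assoc : ∀ (p q r : Poly n) → (p ⊗ q) ⊗ r ≡ p ⊗ (q ⊗ r)
    ⊗-assoc [] q r = refl
    ⊗-assoc ((c , m) ∷ p) q r = begin
        (mulTerm c m q ++ p ⊗ q) ⊗ r
      ≡⟨ ⊗-distribʳ-++ (mulTerm c m q) (p ⊗ q) r ⟩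
        mulTerm c m q ⊗ r ++ (p ⊗ q) ⊗ r
      ≡⟨ cong₂ _++_ (mulTerm-⊗ c m q r) (⊗-assoc p q r) ⟩
        mulTerm c m (q ⊗ r) ++ p ⊗ (q ⊗ r)
      ∎ where open ≡-Reasoning

    ⊗-congˡ : ∀ (p q q′ : Poly n) → q ≈ q′ → p ⊗ q ≈ p ⊗ q′
    ⊗-congˡ [] q q′ q≈q′ e = refl
    ⊗-congˡ ((c , m) ∷ p) q q′ q≈q′ e = begin
        coeff (mulTerm c m q ++ p ⊗ q) e
      ≡⟨ coeff-++ (mulTerm c m q) _ e ⟩
        coeff (mulTerm c m q) e ℤ.+ coeff (p ⊗ q) e
      ≡⟨ cong₂ ℤ._+_ (mulTerm-cong c m q q′ q≈q′ e) (⊗-congˡ p q q′ q≈q′ e) ⟩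
        coeff (mulTerm c m q′) e ℤ.+ coeff (p ⊗ q′) e
      ≡⟨ coeff-++ (mulTerm c m q′) _ e ⟨
        coeff (mulTerm c m q′ ++ p ⊗ q′) e
      ∎ where open ≡-Reasoning

    ⊗-identityˡ : ∀ (p : Poly n) → 1P ⊗ p ≈ p
    ⊗-identityˡ p e = cong (λ z → coeff z e) (≡.trans (List.++-identityʳ _) (mulTerm-one p))

  -- Equality of polynomials wrapped in a record, so that its two sides can be inferred.
  infix 4 _≈ₚ_
  record _≈ₚ_ {n} (p q : Poly n) : Set where
    constructor coeffwise
    field coeff≡ : p ≈ q
  open _≈ₚ_

  polyRing : ℕ → CommutativeRing 0ℓ 0ℓ
  polyRing n = record
    { Carrier = Poly n ; _≈_ = _≈ₚ_ ; _+_ = _⊕_ ; _*_ = _⊗_ ; -_ = negate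
    ; 0# = 0P ; 1# = 1P
    ; isCommutativeRing = record
      { isRing = record
        { +-isAbelianGroup = record
          { isGroup = record
            { isMonoid = record
              { isSemigroup = record
                { isMagma = record { isEquivalence = ≈ₚ-isEquivalence ; ∙-cong = ⊕-cong }
                ; assoc = λ p q r → coeffwise λ e → cong (λ z → coeff z e) (List.++-assoc p q r) }
              ; identity = (λ p → coeffwise λ e → refl)
                         , (λ p → coeffwise λ e → cong (λ z → coeff z e) (List.++-identityʳ p)) }
            ; inverse = negate-inverseˡ , λ p → ⊕-comm p (negate p) ⟨≈⟩ negate-inverseˡ p
            ; ⁻¹-cong = λ {p} {q} p≈q → coeffwise λ e →
                ≡.trans (coeff-negate p e) (≡.trans (cong ℤ.-_ (coeff≡ p≈q e)) (≡.sym (coeff-negate q e))) }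
          ; comm = ⊕-comm }
        ; *-cong = λ {p} {p′} {q} {q′} p≈p′ q≈q′ → coeffwise λ e → begin
            coeff (p ⊗ q) e    ≡⟨ ⊗-congˡ p q q′ (coeff≡ q≈q′) e ⟩
            coeff (p ⊗ q′) e   ≡⟨ ⊗-comm p q′ e ⟩
            coeff (q′ ⊗ p) e   ≡⟨ ⊗-congˡ q′ p p′ (coeff≡ p≈p′) e ⟩
            coeff (q′ ⊗ p′) e  ≡⟨ ⊗-comm q′ p′ e ⟩
            coeff (p′ ⊗ q′) e  ∎
        ; *-assoc = λ p q r → coeffwise λ e → cong (λ z → coeff z e) (⊗-assoc p q r)
        ; *-identity = (λ p → coeffwise (⊗-identityˡ p))
                     , (λ p → coeffwise λ e → ≡.trans (⊗-comm p 1P e) (⊗-identityˡ p e))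
        ; distrib = (λ p q r → coeffwise λ e → ≡.trans (⊗-distribˡ-++ p q r e) (≡.sym (coeff-++ (p ⊗ q) (p ⊗ r) e)))
                  , (λ p q r → coeffwise λ e → cong (λ z → coeff z e) (⊗-distribʳ-++ q r p)) }
      ; *-comm = λ p q → coeffwise (⊗-comm p q) } }
    where
    open ≡-Reasoning

    _⟨≈⟩_ : {p q r : Poly n} → p ≈ₚ q → q ≈ₚ r → p ≈ₚ r
    p≈q ⟨≈⟩ q≈r = coeffwise λ e → ≡.trans (coeff≡ p≈q e) (coeff≡ q≈r e)

    ≈ₚ-isEquivalence : IsEquivalence (_≈ₚ_ {n})
    ≈ₚ-isEquivalence = record
      { refl = coeffwise λ e → refl
      ; sym = λ p≈q → coeffwise λ e → ≡.sym (coeff≡ p≈q e)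
      ; trans = _⟨≈⟩_ }

    ⊕-cong : {p p′ q q′ : Poly n} → p ≈ₚ p′ → q ≈ₚ q′ → p ⊕ q ≈ₚ p′ ⊕ q′
    ⊕-cong {p} {p′} {q} {q′} p≈p′ q≈q′ = coeffwise λ e →
      ≡.trans (coeff-++ p q e) (≡.trans (cong₂ ℤ._+_ (coeff≡ p≈p′ e) (coeff≡ q≈q′ e)) (≡.sym (coeff-++ p′ q′ e)))

    ⊕-comm : (p q : Poly n) → p ⊕ q ≈ₚ q ⊕ p
    ⊕-comm p q = coeffwise λ e →
      ≡.trans (coeff-++ p q e) (≡.trans (ℤ.+-comm (coeff p e) (coeff q e)) (≡.sym (coeff-++ q p e)))

    negate-inverseˡ : (p : Poly n) → negate p ⊕ p ≈ₚ 0P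
    negate-inverseˡ p = coeffwise λ e → begin
      coeff (negate p ++ p) e             ≡⟨ coeff-++ (negate p) p e ⟩
      coeff (negate p) e ℤ.+ coeff p e    ≡⟨ cong (ℤ._+ coeff p e) (coeff-negate p e) ⟩
      ℤ.- coeff p e ℤ.+ coeff p e         ≡⟨ ℤ.+-inverseˡ (coeff p e) ⟩
      ℤ.0ℤ                                ∎

open PolynomialArithmetic using (_≈ₚ_; coeffwise; polyRing)

module Ideals {c ℓ} (R : CommutativeRing c ℓ) where
  open CommutativeRing R hiding (zero) renaming (refl to ≈-refl)
  open import Algebra.Properties.Ring ring using (-‿distribˡ-*)
  open import Algebra.Properties.Group +-group using (//-rightDividesʳ)

  sum : List Carrier → Carrier
  sum = List.foldr _+_ 0#

  sum-++ : ∀ xs ys → sum (xs ++ ys) ≈ sum xs + sum ys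
  sum-++ [] ys = sym (+-identityˡ _)
  sum-++ (x ∷ xs) ys = trans (+-congˡ (sum-++ xs ys)) (sym (+-assoc x _ _))

  combination : List (Carrier × Carrier) → Carrier
  combination ts = sum (map (λ (a , g) → a * g) ts)

  record Ideal (gs : List Carrier) (p : Carrier) : Set (c ⊔ ℓ) where
    constructor ideal
    field
      terms      : List (Carrier × Carrier)
      generators : All (λ t → proj₂ t ∈ gs) terms
      expansion  : p ≈ combination terms

  module _ {gs : List Carrier} where

    Ideal-resp : ∀ {p q} → p ≈ q → Ideal gs q → Ideal gs p
    Ideal-resp p≈q (ideal ts ∈gs q≈) = ideal ts ∈gs (trans p≈q q≈)

    Ideal-0 : Ideal gs 0#
    Ideal-0 = ideal [] [] ≈-refl

    Ideal-gen : ∀ {g} → g ∈ gs → Ideal gs g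
    Ideal-gen {g} g∈gs = ideal ((1# , g) ∷ []) (g∈gs ∷ []) (sym (trans (+-identityʳ _) (*-identityˡ g)))

    Ideal-+ : ∀ {p q} → Ideal gs p → Ideal gs q → Ideal gs (p + q)
    Ideal-+ (ideal ts ∈gs p≈) (ideal us ∈gs′ q≈) = ideal (ts ++ us) (All.++⁺ ∈gs ∈gs′) (begin
      _                                        ≈⟨ +-cong p≈ q≈ ⟩
      combination ts + combination us          ≈⟨ sum-++ (map _ ts) _ ⟨
      sum (map _ ts ++ map _ us)               ≡⟨ cong sum (List.map-++ _ ts us) ⟨
      combination (ts ++ us)                   ∎)
      where open import Relation.Binary.Reasoning.Setoid setoid

    *-combination : ∀ a ts → a * combination ts ≈ combination (map (λ (b , g) → (a * b , g)) ts)
    *-combination a [] = zeroʳ a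
    *-combination a ((b , g) ∷ ts) =
      trans (distribˡ a (b * g) _) (+-cong (sym (*-assoc a b g)) (*-combination a ts))

    Ideal-* : ∀ a {p} → Ideal gs p → Ideal gs (a * p)
    Ideal-* a (ideal ts ∈gs p≈) =
      ideal (map _ ts) (All.map⁺ ∈gs) (trans (*-congˡ p≈) (*-combination a ts))

    Ideal-neg : ∀ {p} → Ideal gs p → Ideal gs (- p)
    Ideal-neg {p} p∈ = Ideal-resp (trans (-‿cong (sym (*-identityˡ p))) (-‿distribˡ-* 1# p)) (Ideal-* (- 1#) p∈)

    Ideal-− : ∀ {p q} → Ideal gs p → Ideal gs q → Ideal gs (p - q)
    Ideal-− p∈ q∈ = Ideal-+ p∈ (Ideal-neg q∈)

    Ideal-+⁻ˡ : ∀ {p q} → Ideal gs (p + q) → Ideal gs q → Ideal gs p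
    Ideal-+⁻ˡ {p} {q} p+q∈ q∈ = Ideal-resp (sym (//-rightDividesʳ q p)) (Ideal-− p+q∈ q∈)

    Ideal-+⁻ʳ : ∀ {p q} → Ideal gs (p + q) → Ideal gs p → Ideal gs q
    Ideal-+⁻ʳ {p} {q} p+q∈ p∈ = Ideal-+⁻ˡ (Ideal-resp (+-comm q p) p+q∈) p∈

  Ideal-⊆ : ∀ {gs hs} → (∀ {g} → g ∈ gs → Ideal hs g) → ∀ {p} → Ideal gs p → Ideal hs p
  Ideal-⊆ {gs} {hs} gs⊆hs (ideal ts ∈gs p≈) = Ideal-resp p≈ (combination∈ ts ∈gs)
    where
    combination∈ : ∀ ts → All (λ t → proj₂ t ∈ gs) ts → Ideal hs (combination ts)
    combination∈ [] [] = Ideal-0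
    combination∈ ((a , g) ∷ ts) (g∈ ∷ ∈gs) = Ideal-+ (Ideal-* a (gs⊆hs g∈)) (combination∈ ts ∈gs)

module AlternatingConvolution {c ℓ} (R : CommutativeRing c ℓ) where
  open CommutativeRing R hiding (zero) renaming (refl to ≈-refl)
  open import Algebra.Properties.Ring ring using (-‿distribˡ-*; -‿distribʳ-*; -0#≈0#)
  open import Algebra.Properties.AbelianGroup +-abelianGroup using (⁻¹-∙-comm)
  open import Algebra.Solver.Ring.NaturalCoefficients.Default commutativeSemiring using (solve; _:+_; _:*_; _:=_)
  open import Relation.Binary.Reasoning.Setoid setoid
  open Ideals R

  Seq : Set c
  Seq = ℕ → Carrier

  -- altConv A B d = Σ_{k ≤ d} (-1)^k A_k B_{d-k}
  altConv : Seq → Seq → ℕ → Carrier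
  altConv A B zero    = A 0 * B 0
  altConv A B (suc d) = A 0 * B (suc d) - altConv (A ∘ suc) B d

  -- multiplication of a generating series by its formal variable
  shift : Seq → Seq
  shift A zero    = 0#
  shift A (suc k) = A k

  sign : ℕ → Carrier
  sign zero    = 1#
  sign (suc k) = - sign k

  sign²≈1 : ∀ k → sign k * sign k ≈ 1#
  sign²≈1 zero = *-identityˡ 1#
  sign²≈1 (suc k) = begin
    - sign k * - sign k    ≈⟨ -‿distribˡ-* (sign k) (- sign k) ⟨
    - (sign k * - sign k)  ≈⟨ -‿cong (-‿distribʳ-* (sign k) (sign k)) ⟨
    - - (sign k * sign k)  ≈⟨ ⁻¹-involutive _ ⟩
    sign k * sign k        ≈⟨ sign²≈1 k ⟩
    1#                     ∎
    where open import Algebra.Properties.Group +-group using (⁻¹-involutive)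

  sign-involutive : ∀ k a → sign k * (sign k * a) ≈ a
  sign-involutive k a = begin
    sign k * (sign k * a)  ≈⟨ *-assoc (sign k) (sign k) a ⟨
    (sign k * sign k) * a  ≈⟨ *-congʳ (sign²≈1 k) ⟩
    1# * a                 ≈⟨ *-identityˡ a ⟩
    a                      ∎

  -‿distrib-+ : ∀ a b → - (a + b) ≈ - a + - b
  -‿distrib-+ a b = sym (⁻¹-∙-comm a b)

  altConv-cong : ∀ {A A′ B B′} → (∀ k → A k ≈ A′ k) → (∀ k → B k ≈ B′ k) → ∀ d → altConv A B d ≈ altConv A′ B′ d
  altConv-cong A≈ B≈ zero    = *-cong (A≈ 0) (B≈ 0)
  altConv-cong A≈ B≈ (suc d) = +-cong (*-cong (A≈ 0) (B≈ (suc d))) (-‿cong (altConv-cong (A≈ ∘ suc) B≈ d))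

  altConv-linearˡ : ∀ A C B y d → altConv (λ k → A k + y * C k) B d ≈ altConv A B d + y * altConv C B d
  altConv-linearˡ A C B y zero =
    solve 4 (λ a c b y → (a :+ y :* c) :* b := a :* b :+ y :* (c :* b)) ≈-refl (A 0) (C 0) (B 0) y
  altConv-linearˡ A C B y (suc d) = begin
      (A 0 + y * C 0) * B (suc d) - altConv (λ k → A (suc k) + y * C (suc k)) B d
    ≈⟨ +-congˡ (-‿cong (altConv-linearˡ (A ∘ suc) (C ∘ suc) B y d)) ⟩
      (A 0 + y * C 0) * B (suc d) - (altConv (A ∘ suc) B d + y * altConv (C ∘ suc) B d)
    ≈⟨ +-congˡ (trans (-‿distrib-+ _ _) (+-congˡ (-‿distribʳ-* y _))) ⟩
      (A 0 + y * C 0) * B (suc d) + (- altConv (A ∘ suc) B d + y * - altConv (C ∘ suc) B d)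
    ≈⟨ solve 6 (λ a c b y u v → (a :+ y :* c) :* b :+ (u :+ y :* v) := (a :* b :+ u) :+ y :* (c :* b :+ v))
         ≈-refl (A 0) (C 0) (B (suc d)) y (- altConv (A ∘ suc) B d) (- altConv (C ∘ suc) B d) ⟩
      altConv A B (suc d) + y * altConv C B (suc d)
    ∎

  altConv-linearʳ : ∀ A B C y d → altConv A (λ k → B k + y * C k) d ≈ altConv A B d + y * altConv A C d
  altConv-linearʳ A B C y zero =
    solve 4 (λ a b c y → a :* (b :+ y :* c) := a :* b :+ y :* (a :* c)) ≈-refl (A 0) (B 0) (C 0) y
  altConv-linearʳ A B C y (suc d) = begin
      A 0 * (B (suc d) + y * C (suc d)) - altConv (A ∘ suc) (λ k → B k + y * C k) d
    ≈⟨ +-congˡ (-‿cong (altConv-linearʳ (A ∘ suc) B C y d)) ⟩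
      A 0 * (B (suc d) + y * C (suc d)) - (altConv (A ∘ suc) B d + y * altConv (A ∘ suc) C d)
    ≈⟨ +-congˡ (trans (-‿distrib-+ _ _) (+-congˡ (-‿distribʳ-* y _))) ⟩
      A 0 * (B (suc d) + y * C (suc d)) + (- altConv (A ∘ suc) B d + y * - altConv (A ∘ suc) C d)
    ≈⟨ solve 6 (λ a b c y u v → a :* (b :+ y :* c) :+ (u :+ y :* v) := (a :* b :+ u) :+ y :* (a :* c :+ v))
         ≈-refl (A 0) (B (suc d)) (C (suc d)) y (- altConv (A ∘ suc) B d) (- altConv (A ∘ suc) C d) ⟩
      altConv A B (suc d) + y * altConv A C (suc d)
    ∎

  altConv-shiftˡ : ∀ A B d → altConv (shift A) B (suc d) ≈ - altConv A B d
  altConv-shiftˡ A B d = trans (+-congʳ (zeroˡ _)) (+-identityˡ _)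

  altConv-shiftʳ : ∀ A B d → altConv A (shift B) (suc d) ≈ altConv A B d
  altConv-shiftʳ A B zero    = trans (+-congˡ (trans (-‿cong (zeroʳ _)) -0#≈0#)) (+-identityʳ _)
  altConv-shiftʳ A B (suc d) = +-congˡ (-‿cong (altConv-shiftʳ (A ∘ suc) B d))

  altConv-zeroˡ : ∀ A B → (∀ k → A k ≈ 0#) → ∀ d → altConv A B d ≈ 0#
  altConv-zeroˡ A B A≈0 zero    = trans (*-congʳ (A≈0 0)) (zeroˡ _)
  altConv-zeroˡ A B A≈0 (suc d) = begin
    A 0 * B (suc d) - altConv (A ∘ suc) B d  ≈⟨ +-cong (trans (*-congʳ (A≈0 0)) (zeroˡ _)) (-‿cong (altConv-zeroˡ (A ∘ suc) B (A≈0 ∘ suc) d)) ⟩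
    0# - 0#                                  ≈⟨ +-congˡ -0#≈0# ⟩
    0# + 0#                                  ≈⟨ +-identityʳ 0# ⟩
    0#                                       ∎

  altConv-last : ∀ A B d → altConv A B (suc d) ≈ altConv A (B ∘ suc) d + sign (suc d) * (A (suc d) * B 0)
  altConv-last A B zero = +-congˡ (begin
    - (A 1 * B 0)         ≈⟨ -‿distribˡ-* (A 1) (B 0) ⟩
    - A 1 * B 0           ≈⟨ *-congʳ (-‿cong (*-identityˡ (A 1))) ⟨
    - (1# * A 1) * B 0    ≈⟨ *-congʳ (-‿distribˡ-* 1# (A 1)) ⟩
    (- 1# * A 1) * B 0    ≈⟨ *-assoc (- 1#) (A 1) (B 0) ⟩
    - 1# * (A 1 * B 0)    ∎)
  altConv-last A B (suc d) = begin
      A 0 * B (suc (suc d)) - altConv (A ∘ suc) B (suc d)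
    ≈⟨ +-congˡ (-‿cong (altConv-last (A ∘ suc) B d)) ⟩
      A 0 * B (suc (suc d)) - (altConv (A ∘ suc) (B ∘ suc) d + sign (suc d) * (A (suc (suc d)) * B 0))
    ≈⟨ +-congˡ (trans (-‿distrib-+ _ _) (+-congˡ (-‿distribˡ-* (sign (suc d)) _))) ⟩
      A 0 * B (suc (suc d)) + (- altConv (A ∘ suc) (B ∘ suc) d + sign (suc (suc d)) * (A (suc (suc d)) * B 0))
    ≈⟨ +-assoc _ _ _ ⟨
      altConv A (B ∘ suc) (suc d) + sign (suc (suc d)) * (A (suc (suc d)) * B 0)
    ∎

  module _ {gs : List Carrier} where

    altConv-Idealˡ : ∀ A B → (∀ k → Ideal gs (A k)) → ∀ d → Ideal gs (altConv A B d)
    altConv-Idealˡ A B A∈ zero    = Ideal-resp (*-comm _ _) (Ideal-* (B 0) (A∈ 0))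
    altConv-Idealˡ A B A∈ (suc d) =
      Ideal-− (Ideal-resp (*-comm _ _) (Ideal-* _ (A∈ 0))) (altConv-Idealˡ (A ∘ suc) B (A∈ ∘ suc) d)

    altConv-Idealʳ : ∀ A B → (∀ k → Ideal gs (B k)) → ∀ d → Ideal gs (altConv A B d)
    altConv-Idealʳ A B B∈ zero    = Ideal-* (A 0) (B∈ 0)
    altConv-Idealʳ A B B∈ (suc d) = Ideal-− (Ideal-* _ (B∈ (suc d))) (altConv-Idealʳ (A ∘ suc) B B∈ d)

module SymmetricFunctions {c ℓ} (R : CommutativeRing c ℓ) (x : ℕ → CommutativeRing.Carrier R) where
  open CommutativeRing R hiding (zero) renaming (refl to ≈-refl)
  open import Algebra.Properties.Ring ring using (-‿distribˡ-*; -‿distribʳ-*; -0#≈0#)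
  open import Algebra.Solver.Ring.NaturalCoefficients.Default commutativeSemiring using (solve; _:+_; _:*_; _:=_)
  open import Relation.Binary.Reasoning.Setoid setoid
  open AlternatingConvolution R

  elementary : ℕ → List ℕ → Carrier
  elementary zero    _       = 1#
  elementary (suc d) []      = 0#
  elementary (suc d) (a ∷ L) = x a * elementary d L + elementary (suc d) L

  complete : ℕ → List ℕ → Carrier
  complete zero    _       = 1#
  complete (suc d) []      = 0#
  complete (suc d) (a ∷ L) = x a * complete d (a ∷ L) + complete (suc d) L


  altConv-elementary-complete : ∀ L M d → altConv (λ k → elementary k L) (λ j → complete j (L ++ M)) d ≈ complete d M
  altConv-elementary-complete [] M zero    = *-identityˡ 1#
  altConv-elementary-complete [] M (suc d) = begin
    1# * complete (suc d) M - altConv (λ k → elementary (suc k) []) (λ j → complete j M) d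
      ≈⟨ +-cong (*-identityˡ _) (trans (-‿cong (altConv-zeroˡ _ _ (λ _ → ≈-refl) d)) -0#≈0#) ⟩
    complete (suc d) M + 0#
      ≈⟨ +-identityʳ _ ⟩
    complete (suc d) M ∎
  altConv-elementary-complete (a ∷ L) M d = begin
      altConv (λ k → elementary k (a ∷ L)) H d
    ≈⟨ altConv-cong elementary-∷ (λ _ → ≈-refl) d ⟩
      altConv (λ k → E k + x a * shift E k) H d
    ≈⟨ altConv-linearˡ E (shift E) H (x a) d ⟩
      altConv E H d + x a * altConv (shift E) H d
    ≈⟨ peel d ⟩
      complete d M
    ∎
    where
    E H H′ : Seq
    E k  = elementary k L
    H j  = complete j (a ∷ L ++ M)
    H′ j = complete j (L ++ M)

    elementary-∷ : ∀ k → elementary k (a ∷ L) ≈ E k + x a * shift E k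
    elementary-∷ zero    = sym (trans (+-congˡ (zeroʳ _)) (+-identityʳ _))
    elementary-∷ (suc k) = +-comm _ _

    complete-∷ : ∀ j → H j + (- x a) * shift H j ≈ H′ j
    complete-∷ zero    = trans (+-congˡ (zeroʳ _)) (+-identityʳ _)
    complete-∷ (suc j) = begin
      (x a * H j + H′ (suc j)) + (- x a) * H j   ≈⟨ +-congˡ (-‿distribˡ-* (x a) (H j)) ⟨
      (x a * H j + H′ (suc j)) - x a * H j       ≈⟨ +-congʳ (+-comm _ _) ⟩
      (H′ (suc j) + x a * H j) - x a * H j       ≈⟨ +-assoc _ _ _ ⟩
      H′ (suc j) + (x a * H j - x a * H j)       ≈⟨ +-congˡ (-‿inverseʳ _) ⟩
      H′ (suc j) + 0#                                ≈⟨ +-identityʳ _ ⟩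
      H′ (suc j)                                     ∎

    peel : ∀ d → altConv E H d + x a * altConv (shift E) H d ≈ complete d M
    peel zero = begin
      altConv E H 0 + x a * (0# * H 0)   ≈⟨ +-congˡ (trans (*-congˡ (zeroˡ _)) (zeroʳ _)) ⟩
      altConv E H 0 + 0#                   ≈⟨ +-identityʳ _ ⟩
      altConv E H 0                        ≈⟨ altConv-elementary-complete L M 0 ⟩
      complete 0 M                             ∎
    peel (suc d) = begin
        altConv E H (suc d) + x a * altConv (shift E) H (suc d)
      ≈⟨ +-congˡ (*-congˡ (trans (altConv-shiftˡ E H d) (-‿cong (sym (altConv-shiftʳ E H d))))) ⟩
        altConv E H (suc d) + x a * - altConv E (shift H) (suc d)
      ≈⟨ +-congˡ (trans (sym (-‿distribʳ-* _ _)) (-‿distribˡ-* _ _)) ⟩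
        altConv E H (suc d) + (- x a) * altConv E (shift H) (suc d)
      ≈⟨ altConv-linearʳ E H (shift H) (- x a) (suc d) ⟨
        altConv E (λ j → H j + (- x a) * shift H j) (suc d)
      ≈⟨ altConv-cong {E} (λ _ → ≈-refl) complete-∷ (suc d) ⟩
        altConv E H′ (suc d)
      ≈⟨ altConv-elementary-complete L M (suc d) ⟩
        complete (suc d) M
      ∎

  elementary-vanishes : ∀ d L → length L < d → elementary d L ≈ 0#
  elementary-vanishes (suc d) [] _ = ≈-refl
  elementary-vanishes (suc d) (a ∷ L) (s≤s |L|<d) = begin
    x a * elementary d L + elementary (suc d) L  ≈⟨ +-cong (*-congˡ (elementary-vanishes d L |L|<d)) (elementary-vanishes (suc d) L (ℕ.m<n⇒m<1+n |L|<d)) ⟩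
    x a * 0# + 0#                    ≈⟨ +-identityʳ _ ⟩
    x a * 0#                         ≈⟨ zeroʳ _ ⟩
    0#                                 ∎

  elementary-∷ʳ : ∀ d L a → elementary (suc d) (L ++ a ∷ []) ≈ elementary (suc d) L + x a * elementary d L
  elementary-∷ʳ d [] a = +-comm _ _
  elementary-∷ʳ zero (b ∷ L) a = trans (+-congˡ (elementary-∷ʳ zero L a)) (sym (+-assoc _ _ _))
  elementary-∷ʳ (suc d) (b ∷ L) a = begin
      x b * elementary (suc d) (L ++ a ∷ []) + elementary (suc (suc d)) (L ++ a ∷ [])
    ≈⟨ +-cong (*-congˡ (elementary-∷ʳ d L a)) (elementary-∷ʳ (suc d) L a) ⟩
      x b * (elementary (suc d) L + x a * elementary d L) + (elementary (suc (suc d)) L + x a * elementary (suc d) L)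
    ≈⟨ solve 6 (λ xb xa p q r s → xb :* (p :+ xa :* q) :+ (r :+ xa :* p) := (xb :* p :+ r) :+ xa :* (xb :* q :+ p))
         ≈-refl (x b) (x a) (elementary (suc d) L) (elementary d L) (elementary (suc (suc d)) L) (elementary (suc d) L) ⟩
      (x b * elementary (suc d) L + elementary (suc (suc d)) L) + x a * (x b * elementary d L + elementary (suc d) L)
    ∎

module Intervals where
  open import Data.Nat using (_+_; _∸_)

  interval : ℕ → ℕ → List ℕ
  interval a zero    = []
  interval a (suc k) = a ∷ interval (suc a) k

  applyUpTo≡interval : ∀ a (f : ℕ → ℕ) k → (∀ i → f i ≡ a + i) → List.applyUpTo f k ≡ interval a k
  applyUpTo≡interval a f zero    f≗ = refl
  applyUpTo≡interval a f (suc k) f≗ = cong₂ _∷_ (≡.trans (f≗ 0) (ℕ.+-identityʳ a))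
    (applyUpTo≡interval (suc a) (f ∘ suc) k λ i → ≡.trans (f≗ (suc i)) (ℕ.+-suc a i))

  range≡interval : ∀ a b → range a b ≡ interval a (suc b ∸ a)
  range≡interval a b = ≡.trans (List.map-upTo (a +_) (suc b ∸ a)) (applyUpTo≡interval a (a +_) _ λ _ → refl)

  interval-++ : ∀ a k l → interval a (k + l) ≡ interval a k ++ interval (a + k) l
  interval-++ a zero    l = cong (λ b → interval b l) (≡.sym (ℕ.+-identityʳ a))
  interval-++ a (suc k) l = cong (a ∷_) (≡.trans (interval-++ (suc a) k l) (cong (λ b → interval (suc a) k ++ interval b l) (≡.sym (ℕ.+-suc a k))))

  interval-∷ʳ : ∀ a k → interval a (suc k) ≡ interval a k ++ a + k ∷ []
  interval-∷ʳ a k = ≡.trans (cong (interval a) (ℕ.+-comm 1 k)) (interval-++ a k 1)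

  length-interval : ∀ a k → length (interval a k) ≡ k
  length-interval a zero    = refl
  length-interval a (suc k) = cong suc (length-interval (suc a) k)

  ∈-interval⁻ : ∀ {i} a k → i ∈ interval a k → a ≤ i × i < a + k
  ∈-interval⁻ a (suc k) (here refl) = ℕ.≤-refl , ℕ.m<m+n a (s≤s z≤n)
  ∈-interval⁻ {i} a (suc k) (there i∈) with ∈-interval⁻ (suc a) k i∈
  ... | a<i , i<a+k = ℕ.<⇒≤ a<i , subst (i <_) (≡.sym (ℕ.+-suc a k)) i<a+k

  ∈-interval⁺ : ∀ {i} a k → a ≤ i → i < a + k → i ∈ interval a k
  ∈-interval⁺ {i} a zero    a≤i i<a = ⊥-elim (ℕ.<⇒≱ (subst (i <_) (ℕ.+-identityʳ a) i<a) a≤i)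
  ∈-interval⁺ {i} a (suc k) a≤i i<a+k with a ℕ.≟ i
  ... | yes refl = here refl
  ... | no a≢i   = there (∈-interval⁺ (suc a) k (ℕ.≤∧≢⇒< a≤i a≢i) (subst (i <_) (ℕ.+-suc a k) i<a+k))

  ∈-range₁⁻ : ∀ {i} m → i ∈ range 1 m → 1 ≤ i × i ≤ m
  ∈-range₁⁻ m i∈ with ∈-interval⁻ 1 m (subst (_ ∈_) (range≡interval 1 m) i∈)
  ... | 1≤i , i<1+m = 1≤i , ℕ.≤-pred i<1+m

  ∈-range₁⁺ : ∀ {i} m → 1 ≤ i → i ≤ m → i ∈ range 1 m
  ∈-range₁⁺ m 1≤i i≤m = subst (_ ∈_) (≡.sym (range≡interval 1 m)) (∈-interval⁺ 1 m 1≤i (s≤s i≤m))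

  module Count {P : Pred ℕ 0ℓ} (P? : Decidable P) where

    count : List ℕ → ℕ
    count L = length (filter P? L)

    count-≥ : ∀ a k c → c ≤ k → (∀ t → a ≤ t → t < a + c → P t) → c ≤ count (interval a k)
    count-≥ a k       zero    _         _    = z≤n
    count-≥ a (suc k) (suc c) (s≤s c≤k) P-initial with P? a
    ... | yes _  = s≤s (count-≥ (suc a) k c c≤k λ t a<t t<a+c → P-initial t (ℕ.<⇒≤ a<t) (subst (t <_) (≡.sym (ℕ.+-suc a c)) t<a+c))
    ... | no ¬Pa = ⊥-elim (¬Pa (P-initial a ℕ.≤-refl (ℕ.m<m+n a (s≤s z≤n))))

    count-last : ∀ a k → count (interval a k) ≡ 0 ⊎ ∃ λ t → a ≤ t × t < a + k × P t × count (interval a k) + a ≤ suc t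
    count-last a zero = inj₁ refl
    count-last a (suc k) with P? a | count-last (suc a) k
    ... | yes Pa | inj₁ none = inj₂ (a , ℕ.≤-refl , ℕ.m<m+n a (s≤s z≤n) , Pa , ℕ.≤-reflexive (cong (λ c → suc c + a) none))
    ... | yes _  | inj₂ (t , a<t , t<a+k , Pt , c≤t) =
      inj₂ (t , ℕ.<⇒≤ a<t , subst (t <_) (≡.sym (ℕ.+-suc a k)) t<a+k , Pt , subst (_≤ suc t) (ℕ.+-suc _ a) c≤t)
    ... | no _   | inj₁ none = inj₁ none
    ... | no _   | inj₂ (t , a<t , t<a+k , Pt , c≤t) =
      inj₂ (t , ℕ.<⇒≤ a<t , subst (t <_) (≡.sym (ℕ.+-suc a k)) t<a+k , Pt , ℕ.≤-trans (ℕ.+-monoʳ-≤ _ (ℕ.n≤1+n a)) c≤t)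

  count-mono : ∀ {P Q : Pred ℕ 0ℓ} (P? : Decidable P) (Q? : Decidable Q) → (∀ {i} → P i → Q i) →
               ∀ L → Count.count P? L ≤ Count.count Q? L
  count-mono P? Q? P⇒Q [] = z≤n
  count-mono P? Q? P⇒Q (a ∷ L) with P? a | Q? a
  ... | yes _  | yes _  = s≤s (count-mono P? Q? P⇒Q L)
  ... | yes Pa | no ¬Qa = ⊥-elim (¬Qa (P⇒Q Pa))
  ... | no _   | yes _  = ℕ.m≤n⇒m≤1+n (count-mono P? Q? P⇒Q L)
  ... | no _   | no _   = count-mono P? Q? P⇒Q L

open Intervals

module _ {n : ℕ} where
  open Ideals (polyRing n)
  open SymmetricFunctions (polyRing n) var

  combination≡sumP : ∀ ts → combination ts ≡ sumP (map (λ t → proj₁ t ⊗ proj₂ t) ts)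
  combination≡sumP [] = refl
  combination≡sumP ((a , g) ∷ ts) = cong (a ⊗ g ⊕_) (combination≡sumP ts)

  InIdeal⇒Ideal : ∀ {gs} p → InIdeal gs p → Ideal gs p
  InIdeal⇒Ideal p (ts , ∈gs , p≈) = ideal ts ∈gs (coeffwise λ e → ≡.trans (p≈ e) (cong (λ q → coeff q e) (≡.sym (combination≡sumP ts))))

  Ideal⇒InIdeal : ∀ {gs p} → Ideal gs p → InIdeal gs p
  Ideal⇒InIdeal (ideal ts ∈gs (coeffwise p≈)) = ts , ∈gs , λ e → ≡.trans (p≈ e) (cong (λ q → coeff q e) (combination≡sumP ts))

  elementary≡eSym : ∀ d L → elementary d L ≡ eSym d L
  elementary≡eSym zero    L       = refl
  elementary≡eSym (suc d) []      = refl
  elementary≡eSym (suc d) (a ∷ L) = cong₂ (λ p q → var a ⊗ p ⊕ q) (elementary≡eSym d L) (elementary≡eSym (suc d) L)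

  complete≡hSym : ∀ d L → complete d L ≡ hSym d L
  complete≡hSym zero    L       = refl
  complete≡hSym (suc d) []      = refl
  complete≡hSym (suc d) (a ∷ L) = cong₂ (λ p q → var a ⊗ p ⊕ q) (complete≡hSym d (a ∷ L)) (complete≡hSym (suc d) L)

module Hessenberg (n : ℕ) (n≥1 : 1 ≤ n) (h : ℕ → ℕ) (H : IsHessenberg n h) where
  open IsHessenberg H
  open import Data.Nat using (_+_; _∸_; _<?_)
  open CommutativeRing (polyRing n) using (_*_; sym; trans; *-identityˡ; *-identityʳ)
  open Ideals (polyRing n)
  open AlternatingConvolution (polyRing n)
  open SymmetricFunctions (polyRing n) var

  I J : Poly n → Set
  I = Ideal (Cgens n h)
  J = Ideal (Jgens n h)

  count : ℕ → ℕ
  count j = Count.count (λ k → h k <? j) (range 1 n)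

  count-interval : ∀ j → count j ≡ Count.count (λ k → h k <? j) (interval 1 n)
  count-interval j = cong (Count.count _) (range≡interval 1 n)

  hₙ≡n : h n ≡ n
  hₙ≡n = ℕ.≤-antisym (upper n n≥1 ℕ.≤-refl) (lower n n≥1 ℕ.≤-refl)

  h-mono : ∀ {t} i → 1 ≤ t → t ≤ i → i ≤ n → h t ≤ h i
  h-mono zero    1≤t t≤0 _ = ⊥-elim (ℕ.<⇒≱ 1≤t t≤0)
  h-mono {t} (suc i) 1≤t t≤1+i 1+i≤n with t ℕ.≟ suc i
  ... | yes refl = ℕ.≤-refl
  ... | no t≢1+i = ℕ.≤-trans (h-mono i 1≤t t≤i (ℕ.<⇒≤ 1+i≤n)) (mono i (ℕ.≤-trans 1≤t t≤i) 1+i≤n)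
    where t≤i = ℕ.≤-pred (ℕ.≤∧≢⇒< t≤1+i t≢1+i)

  count-witness : ∀ j → count j ≡ 0 ⊎ ∃ λ t → 1 ≤ t × t ≤ n × h t < j × count j ≤ t
  count-witness j with Count.count-last (λ k → h k <? j) 1 n
  ... | inj₁ none = inj₁ (≡.trans (count-interval j) none)
  ... | inj₂ (t , 1≤t , t<1+n , ht<j , c+1≤1+t) =
    inj₂ (t , 1≤t , ℕ.≤-pred t<1+n , ht<j , ℕ.≤-pred (subst (_≤ suc t) (≡.trans (ℕ.+-comm _ 1) (cong suc (≡.sym (count-interval j)))) c+1≤1+t))

  count[1+j]≤j : ∀ j → count (suc j) ≤ j
  count[1+j]≤j j with count-witness (suc j)
  ... | inj₁ none = subst (_≤ j) (≡.sym none) z≤n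
  ... | inj₂ (t , 1≤t , t≤n , ht≤j , c≤t) = ℕ.≤-trans c≤t (ℕ.≤-trans (lower t 1≤t t≤n) (ℕ.≤-pred ht≤j))

  β-suc : ∀ j → β n h (suc j) ≡ suc (j ∸ count (suc j))
  β-suc j = ℕ.+-∸-assoc 1 (count[1+j]≤j j)

  β-pos : ∀ {j} → 1 ≤ j → 1 ≤ β n h j
  β-pos {suc j} _ = subst (1 ≤_) (≡.sym (β-suc j)) (s≤s z≤n)

  count≤count[1+j] : ∀ j → count j ≤ count (suc j)
  count≤count[1+j] j = count-mono _ _ ℕ.m≤n⇒m≤1+n (range 1 n)

  β-step : ∀ j → β n h (suc j) ≤ suc (β n h j)
  β-step j = begin
    suc j ∸ count (suc j)  ≤⟨ ℕ.∸-monoʳ-≤ (suc j) (count≤count[1+j] j) ⟩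
    suc j ∸ count j        ≡⟨ ℕ.+-∸-assoc 1 (ℕ.≤-trans (count≤count[1+j] j) (count[1+j]≤j j)) ⟩
    suc (j ∸ count j)      ∎
    where open ℕ.≤-Reasoning

  i≤count[1+hᵢ] : ∀ {i} → 1 ≤ i → i ≤ n → i ≤ count (suc (h i))
  i≤count[1+hᵢ] {i} 1≤i i≤n = subst (i ≤_) (≡.sym (count-interval (suc (h i))))
    (Count.count-≥ _ 1 n i i≤n λ t 1≤t t<1+i → s≤s (h-mono i 1≤t (ℕ.≤-pred t<1+i) i≤n))

  ∈-Cgens⁺ : ∀ {i r} → 1 ≤ i → i ≤ n → r < i → eSym (h i ∸ r) (range 1 (h i)) ∈ Cgens n h
  ∈-Cgens⁺ 1≤i i≤n r<i = ∈-concatMap⁺ _ (lose (∈-range₁⁺ n 1≤i i≤n) (∈-map⁺ _ (∈-upTo⁺ r<i)))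

  ∈-Cgens⁻ : ∀ {g} → g ∈ Cgens n h → ∃ λ i → ∃ λ r → 1 ≤ i × i ≤ n × r < i × g ≡ eSym (h i ∸ r) (range 1 (h i))
  ∈-Cgens⁻ g∈ with find (∈-concatMap⁻ _ {xs = range 1 n} g∈)
  ... | i , i∈ , g∈ᵢ with ∈-map⁻ _ g∈ᵢ
  ... | r , r∈ , refl = i , r , proj₁ (∈-range₁⁻ n i∈) , proj₂ (∈-range₁⁻ n i∈) , ∈-upTo⁻ r∈ , refl

  ∈-Jgens⁺ : ∀ {j} → 1 ≤ j → j ≤ n → hSym (β n h j) (range j n) ∈ Jgens n h
  ∈-Jgens⁺ 1≤j j≤n = ∈-map⁺ _ (∈-range₁⁺ n 1≤j j≤n)

  ∈-Jgens⁻ : ∀ {g} → g ∈ Jgens n h → ∃ λ j → 1 ≤ j × j ≤ n × g ≡ hSym (β n h j) (range j n)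
  ∈-Jgens⁻ g∈ with ∈-map⁻ _ g∈
  ... | j , j∈ , refl = j , proj₁ (∈-range₁⁻ n j∈) , proj₂ (∈-range₁⁻ n j∈) , refl
  eSym-range₁ : ∀ d m → eSym d (range 1 m) ≡ elementary d (interval 1 m)
  eSym-range₁ d m = ≡.trans (cong (eSym d) (range≡interval 1 m)) (≡.sym (elementary≡eSym d _))

  hSym-range : ∀ d j → hSym d (range j n) ≡ complete d (interval j (suc n ∸ j))
  hSym-range d j = ≡.trans (cong (hSym d) (range≡interval j n)) (≡.sym (complete≡hSym d _))

  elementary-gen∈I : ∀ {i r} → 1 ≤ i → i ≤ n → r < i → I (elementary (h i ∸ r) (interval 1 (h i)))
  elementary-gen∈I {i} {r} 1≤i i≤n r<i = subst I (eSym-range₁ (h i ∸ r) (h i)) (Ideal-gen (∈-Cgens⁺ 1≤i i≤n r<i))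

  complete-gen∈J : ∀ {j} → 1 ≤ j → j ≤ n → J (complete (β n h j) (interval j (suc n ∸ j)))
  complete-gen∈J {j} 1≤j j≤n = subst J (hSym-range (β n h j) j) (Ideal-gen (∈-Jgens⁺ 1≤j j≤n))

  split-interval : ∀ m → m ≤ n → interval 1 m ++ interval (suc m) (n ∸ m) ≡ interval 1 n
  split-interval m m≤n = ≡.trans (≡.sym (interval-++ 1 m (n ∸ m))) (cong (interval 1) (ℕ.m+[n∸m]≡n m≤n))

  -- The generators with i = t give e_d(1, …, h_t) for h_t - t < d ≤ h_t; adjoining the
  -- variables x_{h_t + 1}, …, x_m one at a time preserves h_t - t < d.
  elementary-prefix∈I : ∀ {t} m d → 1 ≤ t → t ≤ n → h t ≤ m → m < d + t → I (elementary d (interval 1 m))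
  elementary-prefix∈I {t} m d 1≤t t≤n ht≤m m<d+t with h t ℕ.≟ m
  ... | yes refl with d ℕ.≤? h t
  ...   | yes d≤ht = subst (λ d′ → I (elementary d′ (interval 1 (h t)))) (ℕ.m∸[m∸n]≡n d≤ht)
            (elementary-gen∈I 1≤t t≤n (subst (_≤ t) (ℕ.+-∸-assoc 1 d≤ht) (ℕ.m≤n+o⇒m∸n≤o (suc (h t)) d m<d+t)))
  ...   | no d≰ht = Ideal-resp (elementary-vanishes d _ (subst (_< d) (≡.sym (length-interval 1 (h t))) (ℕ.≰⇒> d≰ht))) Ideal-0
  elementary-prefix∈I zero d 1≤t t≤n ht≤0 _ | no ht≢0 = ⊥-elim (ht≢0 (ℕ.n≤0⇒n≡0 ht≤0))
  elementary-prefix∈I {t} (suc m) zero 1≤t t≤n ht≤1+m 1+m<t | no _ =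
    ⊥-elim (ℕ.<⇒≱ 1+m<t (ℕ.≤-trans (lower t 1≤t t≤n) ht≤1+m))
  elementary-prefix∈I {t} (suc m) (suc d) 1≤t t≤n ht≤1+m 1+m<1+d+t | no ht≢1+m =
    subst (λ L → I (elementary (suc d) L)) (≡.sym (interval-∷ʳ 1 m))
      (Ideal-resp (elementary-∷ʳ d (interval 1 m) (suc m))
        (Ideal-+ (elementary-prefix∈I m (suc d) 1≤t t≤n ht≤m (ℕ.<-trans (ℕ.n<1+n m) 1+m<1+d+t))
                 (Ideal-* (var (suc m)) (elementary-prefix∈I m d 1≤t t≤n ht≤m (ℕ.≤-pred 1+m<1+d+t)))))
    where ht≤m = ℕ.≤-pred (ℕ.≤∧≢⇒< ht≤1+m ht≢1+m)

  elementary-full∈I : ∀ d → I (elementary (suc d) (interval 1 n))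
  elementary-full∈I d = elementary-prefix∈I n (suc d) n≥1 ℕ.≤-refl (ℕ.≤-reflexive hₙ≡n) (s≤s (ℕ.m≤n+m n d))

  -- Take the generating-series identity with M = [] and solve for its k = 0 term.
  complete-full∈I : ∀ d → I (complete (suc d) (interval 1 n))
  complete-full∈I d = subst (λ L → I (complete (suc d) L)) (List.++-identityʳ L)
    (Ideal-resp (sym (*-identityˡ _))
      (Ideal-+⁻ˡ {p = 1P ⊗ complete (suc d) (L ++ [])}
        (Ideal-resp (altConv-elementary-complete L [] (suc d)) Ideal-0)
        (Ideal-neg (altConv-Idealˡ (λ k → elementary (suc k) L) _ elementary-full∈I d))))
    where L = interval 1 n

  elementary-β∈I : ∀ m → I (elementary (β n h (suc m)) (interval 1 m))
  elementary-β∈I m with count-witness (suc m)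
  ... | inj₁ none = Ideal-resp (elementary-vanishes _ _ (subst (_< β n h (suc m)) (≡.sym (length-interval 1 m))
                      (ℕ.≤-reflexive (≡.sym (cong (suc m ∸_) none))))) Ideal-0
  ... | inj₂ (t , 1≤t , t≤n , ht<1+m , c≤t) = subst (λ d → I (elementary d (interval 1 m))) (≡.sym (β-suc m))
    (elementary-prefix∈I m _ 1≤t t≤n (ℕ.≤-pred ht<1+m) (s≤s (begin
      m                         ≤⟨ ℕ.m≤n+m∸n m c ⟩
      c + (m ∸ c)               ≤⟨ ℕ.+-monoˡ-≤ (m ∸ c) c≤t ⟩
      t + (m ∸ c)               ≡⟨ ℕ.+-comm t (m ∸ c) ⟩
      (m ∸ c) + t               ∎)))
    where c = count (suc m)
          open ℕ.≤-Reasoning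

  complete-β∈I : ∀ m → m < n → I (complete (β n h (suc m)) (interval (suc m) (n ∸ m)))
  complete-β∈I m m<n with β n h (suc m) | β-pos {suc m} (s≤s z≤n) | elementary-β∈I m
  ... | suc b | _ | e∈I = Ideal-resp (trans (sym (altConv-elementary-complete L M (suc b))) (altConv-last E C b))
    (Ideal-+ (altConv-Idealʳ E (C ∘ suc) (λ k → subst (λ L′ → I (complete (suc k) L′)) (≡.sym (split-interval m (ℕ.<⇒≤ m<n))) (complete-full∈I k)) b)
             (Ideal-* (sign (suc b)) (Ideal-resp (*-identityʳ _) e∈I)))
    where L = interval 1 m
          M = interval (suc m) (n ∸ m)
          E C : Seq
          E k = elementary k L
          C j = complete j (L ++ M)

  complete-tail∈J : ∀ k j → j + k ≡ suc n → 1 ≤ j → ∀ d → β n h j ≤ d → J (complete d (interval j k))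
  complete-tail∈J zero j _ 1≤j zero βj≤0 = ⊥-elim (ℕ.<⇒≱ (β-pos 1≤j) βj≤0)
  complete-tail∈J zero j _ 1≤j (suc d) _ = Ideal-0
  complete-tail∈J (suc k) j j+1+k≡1+n 1≤j d βj≤d with β n h j ℕ.≟ d
  ... | yes refl = subst (λ l → J (complete (β n h j) (interval j l))) 1+n∸j≡1+k (complete-gen∈J 1≤j j≤n)
    where 1+n∸j≡1+k = ≡.trans (cong (_∸ j) (≡.sym j+1+k≡1+n)) (ℕ.m+n∸m≡n j (suc k))
          j≤n = ℕ.≤-pred (subst (j <_) j+1+k≡1+n (ℕ.m<m+n j (s≤s z≤n)))
  complete-tail∈J (suc k) j _ 1≤j zero βj≤0 | no _ = ⊥-elim (ℕ.<⇒≱ (β-pos 1≤j) βj≤0)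
  complete-tail∈J (suc k) j j+1+k≡1+n 1≤j (suc d) βj≤1+d | no βj≢1+d =
    Ideal-+ (Ideal-* (var j) (complete-tail∈J (suc k) j j+1+k≡1+n 1≤j d βj≤d))
            (complete-tail∈J k (suc j) (≡.trans (≡.sym (ℕ.+-suc j k)) j+1+k≡1+n) (s≤s z≤n) (suc d) (ℕ.≤-trans (β-step j) (s≤s βj≤d)))
    where βj≤d = ℕ.≤-pred (ℕ.≤∧≢⇒< βj≤1+d βj≢1+d)

  complete-full∈J : ∀ d → J (complete (suc d) (interval 1 n))
  complete-full∈J d = complete-tail∈J n 1 refl ℕ.≤-refl (suc d) (ℕ.≤-trans (ℕ.m∸n≤m 1 (count 1)) (s≤s z≤n))

  -- Solve the generating-series identity for its k = d term, which is ±e_d(1, …, m).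
  elementary-prefix∈J : ∀ m d → m ≤ n → 1 ≤ d → β n h (suc m) ≤ d → J (elementary d (interval 1 m))
  elementary-prefix∈J m (suc d) m≤n _ β≤1+d = Ideal-resp (sym (trans (sign-involutive (suc d) _) (*-identityʳ _))) (Ideal-* (sign (suc d)) signed∈J)
    where
    L = interval 1 m
    M = interval (suc m) (n ∸ m)
    E C : Seq
    E k = elementary k L
    C j = complete j (L ++ M)

    signed∈J : J (sign (suc d) * (E (suc d) * 1P))
    signed∈J = Ideal-+⁻ʳ
      (Ideal-resp (trans (sym (altConv-last E C d)) (altConv-elementary-complete L M (suc d)))
        (complete-tail∈J (n ∸ m) (suc m) (cong suc (ℕ.m+[n∸m]≡n m≤n)) (s≤s z≤n) (suc d) β≤1+d))
      (altConv-Idealʳ E (C ∘ suc) (λ k → subst (λ L′ → J (complete (suc k) L′)) (≡.sym (split-interval m m≤n)) (complete-full∈J k)) d)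

  Cgens⊆J : ∀ {g} → g ∈ Cgens n h → J g
  Cgens⊆J g∈ with ∈-Cgens⁻ g∈
  ... | i , r , 1≤i , i≤n , r<i , refl =
    subst J (≡.sym (eSym-range₁ (h i ∸ r) (h i)))
      (elementary-prefix∈J (h i) (h i ∸ r) (upper i 1≤i i≤n) (ℕ.m<n⇒0<n∸m r<hi)
        (ℕ.∸-monoʳ-≤ (suc (h i)) (ℕ.≤-trans r<i (i≤count[1+hᵢ] 1≤i i≤n))))
    where r<hi = ℕ.<-≤-trans r<i (lower i 1≤i i≤n)

  Jgens⊆I : ∀ {g} → g ∈ Jgens n h → I g
  Jgens⊆I g∈ with ∈-Jgens⁻ g∈
  ... | suc m , _ , 1+m≤n , refl =
    subst I (≡.sym (hSym-range (β n h (suc m)) (suc m)))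
      (complete-β∈I m 1+m≤n)

theorem6p9 : (n : ℕ) → 1 ≤ n → (h : ℕ → ℕ) → IsHessenberg n h →
    (p : Poly n) →
      (InIdeal (Cgens n h) p → InIdeal (Jgens n h) p) ×
      (InIdeal (Jgens n h) p → InIdeal (Cgens n h) p)
theorem6p9 n n≥1 h H p =
  (λ p∈I → Ideal⇒InIdeal (Ideal-⊆ Cgens⊆J (InIdeal⇒Ideal p p∈I))) ,
  (λ p∈J → Ideal⇒InIdeal (Ideal-⊆ Jgens⊆I (InIdeal⇒Ideal p p∈J)))
  where open Hessenberg n n≥1 h H
        open Ideals (polyRing n) using (Ideal-⊆)
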